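{- For positive integers $n,t$ and a nonnegative integer $s$, the number of overpartitions of $n$ with exactly $s$ overlined parts and Durfee square of size $t$ equals the number of Schmidt $2$-overpartitions of $n$ with exactly $s$ overlined parts and length $2t$ or $2t-1$.
   Context: An overpartition is a partition (finite weakly decreasing sequence of positive integers) in which the final occurrence of each part value may be overlined; its length is the number of parts. The Durfee square size of an overpartition is that of its underlying partition: the largest $t$ such that at least $t$ parts are $\geq t$. A strict overpartition is an overpartition $(\lambda_1,\ldots,\lambda_l)$ with $\lambda_1>\cdots>\lambda_l$ in which $\lambda_i$ may be overlined only if $\lambda_i-\lambda_{i+1}\geq 2$ or $\lambda_i=\lambda_l$. A Schmidt $2$-overpartition of $n$ is a strict overpartition $(\lambda_1,\lambda_2,\ldots)$ with $\lambda_1+\lambda_3+\lambda_5+\cdots=n$. -}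

module Defs where

open import Data.Nat using (ℕ; zero; suc; _+_; _∸_; _≤ᵇ_; _<ᵇ_; _≡ᵇ_; _*_)
open import Data.Bool using (Bool; true; false; _∧_; _∨_; not; if_then_else_; T)
open import Data.List using (List; []; _∷_; length; filter; upTo; map; foldr)
open import Data.Product using (_×_; _,_; proj₁; proj₂; Σ)
open import Data.Bool.Properties using (T?)

-- An (over)partition is represented as a list of parts (value , overlined?),
-- listed in order λ₁, λ₂, … (weakly / strictly decreasing).
Part : Set
Part = ℕ × Bool

Parts : Set
Parts = List Part

allPos : Parts → Bool
allPos [] = true
allPos ((a , _) ∷ xs) = (1 ≤ᵇ a) ∧ allPos xs

-- Overpartition: weakly decreasing; a part may be overlined only if it is the
-- final occurrence of its value (i.e. the next part, if any, is strictly smaller).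
overOK : Parts → Bool
overOK [] = true
overOK (x ∷ []) = true
overOK ((a , o) ∷ (b , p) ∷ xs) =
  (b ≤ᵇ a) ∧ (not o ∨ (b <ᵇ a)) ∧ overOK ((b , p) ∷ xs)

isOverpartition : Parts → Bool
isOverpartition xs = allPos xs ∧ overOK xs

strictOK : Parts → Bool
strictOK [] = true
strictOK (x ∷ []) = true
strictOK ((a , o) ∷ (b , p) ∷ xs) =
  (b <ᵇ a) ∧ (not o ∨ (2 + b ≤ᵇ a)) ∧ strictOK ((b , p) ∷ xs)

isStrictOverpartition : Parts → Bool
isStrictOverpartition xs = allPos xs ∧ strictOK xs

weight : Parts → ℕ
weight [] = 0
weight ((a , _) ∷ xs) = a + weight xs

oddWeight : Parts → ℕ
evenWeight : Parts → ℕ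
oddWeight [] = 0
oddWeight ((a , _) ∷ xs) = a + evenWeight xs
evenWeight [] = 0
evenWeight (_ ∷ xs) = oddWeight xs

overlined : Parts → ℕ
overlined [] = 0
overlined ((_ , o) ∷ xs) = (if o then 1 else 0) + overlined xs

partsAtLeast : ℕ → Parts → ℕ
partsAtLeast t [] = 0
partsAtLeast t ((a , _) ∷ xs) = (if t ≤ᵇ a then 1 else 0) + partsAtLeast t xs

hasSquare : Parts → ℕ → Bool
hasSquare xs t = t ≤ᵇ partsAtLeast t xs

maxList : List ℕ → ℕ
maxList [] = 0
maxList (x ∷ xs) = if x ≤ᵇ maxList xs then maxList xs else x

-- Durfee square size: the largest t with at least t parts ≥ t.
-- (Any such t is ≤ the length, so the search over 0..length is exhaustive;
-- t = 0 always qualifies.)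
durfee : Parts → ℕ
durfee xs = maxList (filter (λ t → T? (hasSquare xs t)) (upTo (suc (length xs))))

OverpartitionsDurfee : ℕ → ℕ → ℕ → Set
OverpartitionsDurfee n s t =
  Σ Parts λ xs → T (isOverpartition xs ∧ (weight xs ≡ᵇ n)
                    ∧ (overlined xs ≡ᵇ s) ∧ (durfee xs ≡ᵇ t))

Schmidt2Length : ℕ → ℕ → ℕ → Set
Schmidt2Length n s t =
  Σ Parts λ xs → T (isStrictOverpartition xs ∧ (oddWeight xs ≡ᵇ n)
                    ∧ (overlined xs ≡ᵇ s)
                    ∧ ((length xs ≡ᵇ 2 * t) ∨ (length xs ≡ᵇ 2 * t ∸ 1)))

{-# OPTIONS --safe #-}
-- Peel the diagram of λ along its Durfee diagonal: step i records the hook lengths of the diagonal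
-- cell (i , i) and of its right neighbour (i , i + 1), then deletes row i and column i. A Durfee
-- square of size t gives 2t or 2t − 1 strictly decreasing parts (the second hook is absent when the
-- current first row has length 1), and since the diagonal hooks partition the diagram, the
-- odd-indexed parts sum to |λ|. The overline of the current first row moves to the second part of
-- the pair, an overlined final 1 in the first column to the first part; either one forces the gap after
-- that part to be at least 2, which is the overlining rule of strict overpartitions. Running the steps
-- backwards puts the rows and columns back, so the map is a bijection.
module Submission where

open import Defs
open import Data.Bool using (Bool; true; false; _∧_; _∨_; not; T; if_then_else_)
open import Data.Bool.Properties using (T?; T-≡; T-∧; T-∨; T-irrelevant)
open import Data.List using (List; []; _∷_; length; map; _++_; filter; upTo; head)
open import Data.Maybe using (just)
open import Data.Maybe.Relation.Binary.Connected using (Connected; just; just-nothing)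
import Data.List.Relation.Unary.All as All
open All using (All; []; _∷_)
open import Data.List.Relation.Unary.Any using (here; there)
open import Data.List.Membership.Propositional using (_∈_)
open import Data.List.Membership.Propositional.Properties using (∈-filter⁺; ∈-filter⁻; ∈-upTo⁺)
import Data.List.Relation.Unary.Linked as Linked
open Linked using (Linked; []; [-]; _∷_; _∷′_)
open import Data.Nat using (ℕ; zero; suc; _+_; _∸_; _*_; _≤_; _<_; z≤n; s≤s; _≤ᵇ_; _≡ᵇ_)
open import Data.Nat.Properties
open import Data.Nat.Solver using (module +-*-Solver)
open import Data.Product using (_×_; _,_; proj₁; proj₂; Σ; map₁)
open import Data.Sum using (_⊎_; inj₁; inj₂; [_,_]′)
open import Function using (_∘_; _⇔_; mk⇔; Equivalence)
open import Function.Bundles using (_↔_; mk↔ₛ′)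
open import Function.Properties.Equivalence using () renaming (trans to ⇔-trans)
open import Data.Product.Function.NonDependent.Propositional using (_×-⇔_)
open import Data.Sum.Function.Propositional using (_⊎-⇔_)
open import Relation.Binary.PropositionalEquality
open import Relation.Nullary using (¬_; Dec; contradiction)

open Equivalence using (to; from)

Positive : Part → Set
Positive (a , _) = 1 ≤ a

_≽_ : Part → Part → Set
(a , o) ≽ (b , _) = b ≤ a × (T o → b < a)

_≻_ : Part → Part → Set
(a , o) ≻ (b , _) = b < a × (T o → 2 + b ≤ a)

IsOverpartition : Parts → Set
IsOverpartition xs = All Positive xs × Linked _≽_ xs

IsStrictOverpartition : Parts → Set
IsStrictOverpartition xs = All Positive xs × Linked _≻_ xs

T-not-∨ : ∀ {o c} → T (not o ∨ c) ⇔ (T o → T c)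
T-not-∨ {true}  = mk⇔ (λ c _ → c) (λ f → f _)
T-not-∨ {false} = mk⇔ (λ _ ()) (λ _ → _)

allPos⇔ : ∀ xs → T (allPos xs) ⇔ All Positive xs
allPos⇔ xs = mk⇔ (⇒ xs) ⇐
  where
  ⇒ : ∀ xs → T (allPos xs) → All Positive xs
  ⇒ [] _ = []
  ⇒ ((a , _) ∷ xs) h = let (1≤a , pos) = to T-∧ h in ≤ᵇ⇒≤ 1 a 1≤a ∷ ⇒ xs pos
  ⇐ : ∀ {xs} → All Positive xs → T (allPos xs)
  ⇐ [] = _
  ⇐ (1≤a ∷ pos) = from T-∧ (≤⇒≤ᵇ 1≤a , ⇐ pos)

overOK⇔ : ∀ xs → T (overOK xs) ⇔ Linked _≽_ xs
overOK⇔ xs = mk⇔ (⇒ xs) ⇐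
  where
  ⇒ : ∀ xs → T (overOK xs) → Linked _≽_ xs
  ⇒ [] _ = []
  ⇒ (_ ∷ []) _ = [-]
  ⇒ ((a , o) ∷ (b , _) ∷ xs) h =
    let (b≤a , h′) = to T-∧ h ; (o⇒b<a , ok) = to T-∧ h′
    in (≤ᵇ⇒≤ b a b≤a , <ᵇ⇒< b a ∘ to T-not-∨ o⇒b<a) ∷ ⇒ _ ok
  ⇐ : ∀ {xs} → Linked _≽_ xs → T (overOK xs)
  ⇐ [] = _
  ⇐ [-] = _
  ⇐ ((b≤a , o⇒b<a) ∷ ok) =
    from T-∧ (≤⇒≤ᵇ b≤a , from T-∧ (from T-not-∨ (<⇒<ᵇ ∘ o⇒b<a) , ⇐ ok))

strictOK⇔ : ∀ xs → T (strictOK xs) ⇔ Linked _≻_ xs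
strictOK⇔ xs = mk⇔ (⇒ xs) ⇐
  where
  ⇒ : ∀ xs → T (strictOK xs) → Linked _≻_ xs
  ⇒ [] _ = []
  ⇒ (_ ∷ []) _ = [-]
  ⇒ ((a , o) ∷ (b , _) ∷ xs) h =
    let (b<a , h′) = to T-∧ h ; (o⇒2+b≤a , ok) = to T-∧ h′
    in (<ᵇ⇒< b a b<a , ≤ᵇ⇒≤ (2 + b) a ∘ to T-not-∨ o⇒2+b≤a) ∷ ⇒ _ ok
  ⇐ : ∀ {xs} → Linked _≻_ xs → T (strictOK xs)
  ⇐ [] = _
  ⇐ [-] = _
  ⇐ ((b<a , o⇒2+b≤a) ∷ ok) =
    from T-∧ (<⇒<ᵇ b<a , from T-∧ (from T-not-∨ (≤⇒≤ᵇ ∘ o⇒2+b≤a) , ⇐ ok))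

≡ᵇ⇔ : ∀ {m n} → T (m ≡ᵇ n) ⇔ m ≡ n
≡ᵇ⇔ = mk⇔ (≡ᵇ⇒≡ _ _) (≡⇒≡ᵇ _ _)

≤ᵇ≡true⇒≤ : ∀ {m n} → (m ≤ᵇ n) ≡ true → m ≤ n
≤ᵇ≡true⇒≤ {m} {n} m≤ᵇn = ≤ᵇ⇒≤ m n (from T-≡ m≤ᵇn)

≤ᵇ≡false⇒> : ∀ {m n} → (m ≤ᵇ n) ≡ false → n < m
≤ᵇ≡false⇒> m≤ᵇn = ≰⇒> (subst T m≤ᵇn ∘ ≤⇒≤ᵇ)

n<m⇒m≤ᵇn≡false : ∀ {m n} → n < m → (m ≤ᵇ n) ≡ false
n<m⇒m≤ᵇn≡false {m} {n} n<m with m ≤ᵇ n in m≤ᵇn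
... | true  = contradiction (≤ᵇ≡true⇒≤ m≤ᵇn) (<⇒≱ n<m)
... | false = refl

HasDurfee : Parts → ℕ → Set
HasDurfee xs t = t ≤ partsAtLeast t xs × partsAtLeast (suc t) xs ≤ t

HasDurfee-[] : ∀ {t} → HasDurfee [] t → t ≡ 0
HasDurfee-[] (z≤n , _) = refl

HasDurfee-0 : ∀ {xs} → All Positive xs → HasDurfee xs 0 → xs ≡ []
HasDurfee-0 [] _ = refl
HasDurfee-0 {(suc _ , _) ∷ _} _ (_ , ())

partsAtLeast-antitone : ∀ {j k} xs → j ≤ k → partsAtLeast k xs ≤ partsAtLeast j xs
partsAtLeast-antitone [] _ = z≤n
partsAtLeast-antitone {j} {k} ((a , _) ∷ xs) j≤k with k ≤ᵇ a in k≤ᵇa | j ≤ᵇ a in j≤ᵇa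
... | true  | true  = s≤s (partsAtLeast-antitone xs j≤k)
... | false | true  = m≤n⇒m≤1+n (partsAtLeast-antitone xs j≤k)
... | false | false = partsAtLeast-antitone xs j≤k
... | true  | false = contradiction (≤-trans j≤k (≤ᵇ≡true⇒≤ k≤ᵇa)) (<⇒≱ (≤ᵇ≡false⇒> j≤ᵇa))

partsAtLeast≤length : ∀ k xs → partsAtLeast k xs ≤ length xs
partsAtLeast≤length k [] = z≤n
partsAtLeast≤length k ((a , _) ∷ xs) with k ≤ᵇ a
... | true  = s≤s (partsAtLeast≤length k xs)
... | false = m≤n⇒m≤1+n (partsAtLeast≤length k xs)

maxList-upperBound : ∀ {k} xs → k ∈ xs → k ≤ maxList xs
maxList-upperBound (x ∷ xs) k∈ with x ≤ᵇ maxList xs in x≤ᵇmax | k∈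
... | true  | here refl = ≤ᵇ≡true⇒≤ x≤ᵇmax
... | true  | there k∈xs = maxList-upperBound xs k∈xs
... | false | here refl = ≤-refl
... | false | there k∈xs = ≤-trans (maxList-upperBound xs k∈xs) (<⇒≤ (≤ᵇ≡false⇒> x≤ᵇmax))

maxList-least : ∀ {t xs} → All (_≤ t) xs → maxList xs ≤ t
maxList-least [] = z≤n
maxList-least {xs = x ∷ xs} (x≤t ∷ xs≤t) with x ≤ᵇ maxList xs
... | true  = maxList-least xs≤t
... | false = x≤t

maxList-∷ : ∀ x xs → maxList (x ∷ xs) ≡ x ⊎ maxList (x ∷ xs) ≡ maxList xs
maxList-∷ x xs with x ≤ᵇ maxList xs
... | true  = inj₂ refl
... | false = inj₁ refl

maxList-∈ : ∀ {k} xs → k ∈ xs → maxList xs ∈ xs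
maxList-∈ (zero  ∷ []) _ = here refl
maxList-∈ (suc _ ∷ []) _ = here refl
maxList-∈ (x ∷ y ∷ xs) _ =
  [ here , (λ max≡ → there (subst (_∈ y ∷ xs) (sym max≡) (maxList-∈ (y ∷ xs) (here refl)))) ]′
  (maxList-∷ x (y ∷ xs))

module _ (xs : Parts) where

  private
    square? : ∀ t → Dec (T (hasSquare xs t))
    square? t = T? (hasSquare xs t)

    candidates : List ℕ
    candidates = filter square? (upTo (suc (length xs)))

    ∈-candidates : ∀ {k} → k ≤ partsAtLeast k xs → k ∈ candidates
    ∈-candidates {k} k≤ =
      ∈-filter⁺ square? (∈-upTo⁺ (s≤s (≤-trans k≤ (partsAtLeast≤length k xs)))) (≤⇒≤ᵇ k≤)

    candidate-square : ∀ {k} → k ∈ candidates → k ≤ partsAtLeast k xs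
    candidate-square {k} k∈ = ≤ᵇ⇒≤ k _ (proj₂ (∈-filter⁻ square? {xs = upTo (suc (length xs))} k∈))

  durfee⇔HasDurfee : ∀ t → durfee xs ≡ t ⇔ HasDurfee xs t
  durfee⇔HasDurfee t = mk⇔ ⇒ ⇐
    where
    durfee∈ : durfee xs ∈ candidates
    durfee∈ = maxList-∈ candidates (∈-candidates {0} z≤n)
    ⇒ : durfee xs ≡ t → HasDurfee xs t
    ⇒ refl = candidate-square durfee∈ ,
             ≮⇒≥ λ 1+t≤ → 1+n≰n (maxList-upperBound candidates (∈-candidates 1+t≤))
    ⇐ : HasDurfee xs t → durfee xs ≡ t
    ⇐ (t≤ , ≤t) =
      ≤-antisym (maxList-least (All.tabulate below-t)) (maxList-upperBound candidates (∈-candidates t≤))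
      where
      below-t : ∀ {k} → k ∈ candidates → k ≤ t
      below-t {k} k∈ = ≮⇒≥ λ t<k →
        <⇒≱ t<k (≤-trans (candidate-square k∈) (≤-trans (partsAtLeast-antitone xs t<k) ≤t))

barCount : Bool → ℕ
barCount b = if b then 1 else 0

-- k parts equal to 1, the last one overlined iff b; for k = 0 the flag b is lost.
ones : ℕ → Bool → Parts
ones zero          _ = []
ones (suc zero)    b = (1 , b) ∷ []
ones (suc (suc k)) b = (1 , false) ∷ ones (suc k) b

addColumn : Parts → ℕ → Bool → Parts
addColumn xs k b = map (map₁ suc) xs ++ ones k b

removeColumn : Parts → Parts
removeColumn []                      = []
removeColumn ((suc (suc a) , o) ∷ xs) = (suc a , o) ∷ removeColumn xs
removeColumn (_ ∷ xs)                = removeColumn xs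

countOnes : Parts → ℕ
countOnes []                 = 0
countOnes ((suc zero , _) ∷ xs) = suc (countOnes xs)
countOnes (_ ∷ xs)           = countOnes xs

endsInBarredOne : Parts → Bool
endsInBarredOne []                  = false
endsInBarredOne ((suc zero , o) ∷ []) = o
endsInBarredOne (_ ∷ [])            = false
endsInBarredOne (_ ∷ x ∷ xs)        = endsInBarredOne (x ∷ xs)

firstValue : Parts → ℕ
firstValue []            = 0
firstValue ((a , _) ∷ _) = a

hook : Parts → ℕ
hook []               = 0
hook ((a , _) ∷ rest) = a + length rest

length-ones : ∀ k b → length (ones k b) ≡ k
length-ones zero          _ = refl
length-ones (suc zero)    _ = refl
length-ones (suc (suc k)) b = cong suc (length-ones (suc k) b)

weight-ones : ∀ k b → weight (ones k b) ≡ k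
weight-ones zero          _ = refl
weight-ones (suc zero)    _ = refl
weight-ones (suc (suc k)) b = cong suc (weight-ones (suc k) b)

overlined-ones : ∀ k b → (T b → 1 ≤ k) → overlined (ones k b) ≡ barCount b
overlined-ones zero          false _ = refl
overlined-ones zero          true  b⇒1≤0 = contradiction (b⇒1≤0 _) λ ()
overlined-ones (suc zero)    b     _ = +-identityʳ (barCount b)
overlined-ones (suc (suc k)) b     _ = overlined-ones (suc k) b λ _ → s≤s z≤n

endsInBarredOne-ones : ∀ k b → (T b → 1 ≤ k) → endsInBarredOne (ones k b) ≡ b
endsInBarredOne-ones zero          false _ = refl
endsInBarredOne-ones zero          true  b⇒1≤0 = contradiction (b⇒1≤0 _) λ ()
endsInBarredOne-ones (suc k)       b     _ = ends k
  where
  ends : ∀ k → endsInBarredOne (ones (suc k) b) ≡ b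
  ends zero          = refl
  ends (suc zero)    = refl
  ends (suc (suc k)) = ends (suc k)

removeColumn-ones : ∀ k b → removeColumn (ones k b) ≡ []
removeColumn-ones zero          _ = refl
removeColumn-ones (suc zero)    _ = refl
removeColumn-ones (suc (suc k)) b = removeColumn-ones (suc k) b

ones-positive : ∀ k b → All Positive (ones k b)
ones-positive zero          _ = []
ones-positive (suc zero)    _ = s≤s z≤n ∷ []
ones-positive (suc (suc k)) b = s≤s z≤n ∷ ones-positive (suc k) b

ones-linked : ∀ k b → Linked _≽_ (ones k b)
ones-linked zero                _ = []
ones-linked (suc zero)          _ = [-]
ones-linked (suc (suc zero))    _ = (≤-refl , λ ()) ∷ [-]
ones-linked (suc (suc (suc k))) b = (≤-refl , λ ()) ∷ ones-linked (suc (suc k)) b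

partsAtLeast-ones : ∀ j k b → partsAtLeast (2 + j) (ones k b) ≡ 0
partsAtLeast-ones j zero          _ = refl
partsAtLeast-ones j (suc zero)    _ = refl
partsAtLeast-ones j (suc (suc k)) b = partsAtLeast-ones j (suc k) b

partsAtLeast1-ones : ∀ k b → partsAtLeast 1 (ones k b) ≡ k
partsAtLeast1-ones zero          _ = refl
partsAtLeast1-ones (suc zero)    _ = refl
partsAtLeast1-ones (suc (suc k)) b = cong suc (partsAtLeast1-ones (suc k) b)

ones-HasDurfee : ∀ k b → HasDurfee (ones (suc k) b) 1
ones-HasDurfee k b =
  subst (1 ≤_) (sym (partsAtLeast1-ones (suc k) b)) (s≤s z≤n) ,
  subst (_≤ 1) (sym (partsAtLeast-ones 0 (suc k) b)) z≤n

hook-ones : ∀ k b → hook (ones (suc k) b) ≡ suc k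
hook-ones zero    _ = refl
hook-ones (suc k) b = cong suc (length-ones (suc k) b)

length-addColumn : ∀ xs k b → length (addColumn xs k b) ≡ length xs + k
length-addColumn []       k b = length-ones k b
length-addColumn (_ ∷ xs) k b = cong suc (length-addColumn xs k b)

weight-addColumn : ∀ xs k b → weight (addColumn xs k b) ≡ weight xs + length xs + k
weight-addColumn []             k b = weight-ones k b
weight-addColumn ((a , _) ∷ xs) k b = begin
  suc a + weight (addColumn xs k b)  ≡⟨ cong (suc a +_) (weight-addColumn xs k b) ⟩
  suc a + (weight xs + length xs + k) ≡⟨ solve 4 (λ a w l k → con 1 :+ a :+ (w :+ l :+ k) := a :+ w :+ (con 1 :+ l) :+ k)
                                                  refl a (weight xs) (length xs) k ⟩
  a + weight xs + suc (length xs) + k ∎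
  where
  open ≡-Reasoning
  open +-*-Solver using (solve; _:+_; _:=_; con)

overlined-addColumn : ∀ xs k b → overlined (addColumn xs k b) ≡ overlined xs + overlined (ones k b)
overlined-addColumn []             k b = refl
overlined-addColumn ((_ , o) ∷ xs) k b =
  trans (cong (barCount o +_) (overlined-addColumn xs k b)) (sym (+-assoc (barCount o) (overlined xs) _))

endsInBarredOne-∷ : ∀ {a} o xs → 2 ≤ a → endsInBarredOne ((a , o) ∷ xs) ≡ endsInBarredOne xs
endsInBarredOne-∷ {suc (suc _)} _ []      _ = refl
endsInBarredOne-∷ {suc (suc _)} _ (_ ∷ _) _ = refl
endsInBarredOne-∷ {suc zero}    _ _       (s≤s ())

endsInBarredOne-addColumn : ∀ {xs} k b → All Positive xs →
                            endsInBarredOne (addColumn xs k b) ≡ endsInBarredOne (ones k b)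
endsInBarredOne-addColumn k b [] = refl
endsInBarredOne-addColumn {(_ , o) ∷ xs} k b (1≤a ∷ pos) =
  trans (endsInBarredOne-∷ o (addColumn xs k b) (s≤s 1≤a)) (endsInBarredOne-addColumn k b pos)

removeColumn-addColumn : ∀ {xs} k b → All Positive xs → removeColumn (addColumn xs k b) ≡ xs
removeColumn-addColumn k b [] = removeColumn-ones k b
removeColumn-addColumn {(suc _ , _) ∷ _} k b (_ ∷ pos) = cong (_ ∷_) (removeColumn-addColumn k b pos)

addColumn-positive : ∀ xs k b → All Positive (addColumn xs k b)
addColumn-positive []       k b = ones-positive k b
addColumn-positive (_ ∷ xs) k b = s≤s z≤n ∷ addColumn-positive xs k b

addColumn-linked : ∀ {xs} k b → All Positive xs → Linked _≽_ xs → Linked _≽_ (addColumn xs k b)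
addColumn-linked k b [] [] = ones-linked k b
addColumn-linked {(a , o) ∷ []} k b (1≤a ∷ []) [-] = above-ones k
  where
  above-ones : ∀ k → Linked _≽_ ((suc a , o) ∷ ones k b)
  above-ones zero          = [-]
  above-ones (suc zero)    = (s≤s z≤n , λ _ → s≤s 1≤a) ∷ [-]
  above-ones (suc (suc k)) = (s≤s z≤n , λ _ → s≤s 1≤a) ∷ ones-linked (suc (suc k)) b
addColumn-linked k b (_ ∷ pos) ((b≤a , o⇒b<a) ∷ lnk) =
  (s≤s b≤a , s≤s ∘ o⇒b<a) ∷ addColumn-linked k b pos lnk

addColumn-linked⁻ : ∀ xs {k b} → Linked _≽_ (addColumn xs k b) → Linked _≽_ xs
addColumn-linked⁻ []           _ = []
addColumn-linked⁻ (_ ∷ [])     _ = [-]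
addColumn-linked⁻ (_ ∷ y ∷ xs) ((b≤a , o⇒b<a) ∷ lnk) =
  (≤-pred b≤a , ≤-pred ∘ o⇒b<a) ∷ addColumn-linked⁻ (y ∷ xs) lnk

removeColumn-positive : ∀ xs → All Positive (removeColumn xs)
removeColumn-positive []                      = []
removeColumn-positive ((zero , _) ∷ xs)        = removeColumn-positive xs
removeColumn-positive ((suc zero , _) ∷ xs)    = removeColumn-positive xs
removeColumn-positive ((suc (suc _) , _) ∷ xs) = s≤s z≤n ∷ removeColumn-positive xs

onesRun : ∀ {o ys} → All Positive ys → Linked _≽_ ((1 , o) ∷ ys) →
          (1 , o) ∷ ys ≡ ones (suc (countOnes ys)) (endsInBarredOne ((1 , o) ∷ ys))
onesRun [] [-] = refl
onesRun {true}  {(suc zero , _) ∷ _} _ ((_ , 1<1) ∷ _) = contradiction (1<1 _) (<-irrefl refl)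
onesRun {false} {(suc zero , _) ∷ _} (_ ∷ pos) (_ ∷ lnk) = cong (_ ∷_) (onesRun pos lnk)
onesRun {ys = (suc (suc _) , _) ∷ _} _ ((s≤s () , _) ∷ _)

removeColumn-onesRun : ∀ {o ys} → All Positive ys → Linked _≽_ ((1 , o) ∷ ys) → removeColumn ys ≡ []
removeColumn-onesRun {o} {ys} pos lnk =
  trans (cong removeColumn (onesRun pos lnk)) (removeColumn-ones (suc (countOnes ys)) (endsInBarredOne ((1 , o) ∷ ys)))

column-decomposition : ∀ {xs} → All Positive xs → Linked _≽_ xs →
                       xs ≡ addColumn (removeColumn xs) (countOnes xs) (endsInBarredOne xs)
column-decomposition [] _ = refl
column-decomposition {(suc zero , _) ∷ _} (_ ∷ pos) lnk
  rewrite removeColumn-onesRun pos lnk = onesRun pos lnk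
column-decomposition {(suc (suc a) , o) ∷ ys} (_ ∷ pos) lnk
  rewrite endsInBarredOne-∷ {2 + a} o ys (s≤s (s≤s z≤n)) =
  cong (_ ∷_) (column-decomposition pos (Linked.tail lnk))

removeColumn-linked : ∀ {xs} → All Positive xs → Linked _≽_ xs → Linked _≽_ (removeColumn xs)
removeColumn-linked pos lnk = addColumn-linked⁻ _ (subst (Linked _≽_) (column-decomposition pos lnk) lnk)

length-removeColumn : ∀ {xs} → All Positive xs → Linked _≽_ xs →
                      length xs ≡ length (removeColumn xs) + countOnes xs
length-removeColumn {xs} pos lnk = trans (cong length (column-decomposition pos lnk))
  (length-addColumn (removeColumn xs) (countOnes xs) (endsInBarredOne xs))

endsInBarredOne⇒countOnes : ∀ xs → T (endsInBarredOne xs) → 1 ≤ countOnes xs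
endsInBarredOne⇒countOnes ((suc zero , true) ∷ [])   _ = s≤s z≤n
endsInBarredOne⇒countOnes ((zero , _) ∷ y ∷ ys)        h = endsInBarredOne⇒countOnes (y ∷ ys) h
endsInBarredOne⇒countOnes ((suc zero , _) ∷ y ∷ ys)    h = m≤n⇒m≤1+n (endsInBarredOne⇒countOnes (y ∷ ys) h)
endsInBarredOne⇒countOnes ((suc (suc _) , _) ∷ y ∷ ys) h = endsInBarredOne⇒countOnes (y ∷ ys) h

length≤hook : ∀ {xs} → All Positive xs → length xs ≤ hook xs
length≤hook []                   = z≤n
length≤hook {_ ∷ rest} (1≤a ∷ _) = +-monoˡ-≤ (length rest) 1≤a

partsAtLeast-removeColumn : ∀ j {xs} → All Positive xs →
                            partsAtLeast (2 + j) xs ≡ partsAtLeast (suc j) (removeColumn xs)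
partsAtLeast-removeColumn j [] = refl
partsAtLeast-removeColumn j {(suc zero , _) ∷ _}    (_ ∷ pos) = partsAtLeast-removeColumn j pos
partsAtLeast-removeColumn j {(suc (suc a) , _) ∷ _} (_ ∷ pos) =
  cong (barCount (suc j ≤ᵇ suc a) +_) (partsAtLeast-removeColumn j pos)

partsAtLeast-aboveHead : ∀ {j a o xs} → Linked _≽_ ((a , o) ∷ xs) → a < j → partsAtLeast j xs ≡ 0
partsAtLeast-aboveHead [-] _ = refl
partsAtLeast-aboveHead {xs = (b , _) ∷ _} ((b≤a , _) ∷ lnk) a<j
  rewrite n<m⇒m≤ᵇn≡false (≤-<-trans b≤a a<j) = partsAtLeast-aboveHead lnk (≤-<-trans b≤a a<j)

square-removeColumn : ∀ k {a o rest} → All Positive ((a , o) ∷ rest) → Linked _≽_ ((a , o) ∷ rest) →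
                      suc k ≤ partsAtLeast (suc k) ((a , o) ∷ rest) ⇔ k ≤ partsAtLeast k (removeColumn rest)
square-removeColumn zero    {suc _} _          _ = mk⇔ (λ _ → z≤n) (λ _ → s≤s z≤n)
square-removeColumn zero    {zero}  (() ∷ _)   _
square-removeColumn (suc j) {a} {rest = rest} (_ ∷ pos) lnk
  rewrite sym (partsAtLeast-removeColumn j pos) with suc (suc j) ≤ᵇ a in 2+j≤ᵇa
... | true  = mk⇔ ≤-pred s≤s
... | false = mk⇔ (λ h → contradiction h (no-square (suc j))) (λ h → contradiction h (no-square j))
  where
  a<2+j : a < 2 + j
  a<2+j = ≤ᵇ≡false⇒> 2+j≤ᵇa
  no-square : ∀ i → ¬ (suc i ≤ partsAtLeast (2 + j) rest)
  no-square i h = contradiction (subst (suc i ≤_) (partsAtLeast-aboveHead lnk a<2+j) h) λ ()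

HasDurfee-removeColumn : ∀ t {a o rest} → All Positive ((a , o) ∷ rest) → Linked _≽_ ((a , o) ∷ rest) →
                         HasDurfee ((a , o) ∷ rest) (suc t) ⇔ HasDurfee (removeColumn rest) t
HasDurfee-removeColumn t {a} {o} {rest} pos lnk = mk⇔
  (λ (sq , ≤1+t) → to (square t) sq ,
                   ≮⇒≥ (λ 1+t≤ → <⇒≱ (s≤s ≤-refl) (≤-trans (from (square (suc t)) 1+t≤) ≤1+t)))
  (λ (sq , ≤t)   → from (square t) sq ,
                   ≮⇒≥ (λ 2+t≤ → <⇒≱ (s≤s ≤-refl) (≤-trans (to (square (suc t)) 2+t≤) ≤t)))
  where
  square : ∀ k → suc k ≤ partsAtLeast (suc k) ((a , o) ∷ rest) ⇔ k ≤ partsAtLeast k (removeColumn rest)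
  square k = square-removeColumn k pos lnk

data SchmidtLength : ℕ → ℕ → Set where
  empty  : SchmidtLength 0 0
  single : SchmidtLength 1 1
  step   : ∀ {t l} → SchmidtLength t l → SchmidtLength (suc t) (2 + l)

SchmidtLength⇔ : ∀ {t l} → (l ≡ 2 * t ⊎ l ≡ 2 * t ∸ 1) ⇔ SchmidtLength t l
SchmidtLength⇔ = mk⇔ ⇒ ⇐
  where
  ⇒ : ∀ {t l} → l ≡ 2 * t ⊎ l ≡ 2 * t ∸ 1 → SchmidtLength t l
  ⇒ {zero}        (inj₁ refl) = empty
  ⇒ {zero}        (inj₂ refl) = empty
  ⇒ {suc t}       (inj₁ refl) = subst (SchmidtLength (suc t)) (sym (*-suc 2 t)) (step (⇒ (inj₁ refl)))
  ⇒ {suc zero}    (inj₂ refl) = single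
  ⇒ {suc (suc t)} (inj₂ refl) =
    subst (SchmidtLength (2 + t)) (sym (cong (_∸ 1) (*-suc 2 (suc t)))) (step (⇒ (inj₂ refl)))
  ⇐ : ∀ {t l} → SchmidtLength t l → l ≡ 2 * t ⊎ l ≡ 2 * t ∸ 1
  ⇐ empty = inj₁ refl
  ⇐ single = inj₂ refl
  ⇐ (step {zero} empty) = inj₁ refl
  ⇐ (step {suc t} p) with ⇐ p
  ... | inj₁ refl = inj₁ (sym (*-suc 2 (suc t)))
  ... | inj₂ refl = inj₂ (sym (cong (_∸ 1) (*-suc 2 (suc t))))

-- The first argument is the number of diagonal hooks still to be peeled, i.e. the Durfee size.
toSchmidt : ℕ → Parts → Parts
afterFirstHook : ℕ → Part → Parts → Parts

toSchmidt zero    _                = []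
toSchmidt (suc t) []               = []
toSchmidt (suc t) ((a , o) ∷ rest) =
  (a + length rest , endsInBarredOne ((a , o) ∷ rest)) ∷ afterFirstHook t (a , o) rest

afterFirstHook t (suc (suc a) , o) rest =
  (suc a + length (removeColumn rest) , o) ∷ toSchmidt t (removeColumn rest)
afterFirstHook t _ _ = []

toSchmidt-≥2 : ∀ t {a} o rest → 2 ≤ a → toSchmidt (suc t) ((a , o) ∷ rest) ≡
               (a + length rest , endsInBarredOne rest) ∷ (a ∸ 1 + length (removeColumn rest) , o)
               ∷ toSchmidt t (removeColumn rest)
toSchmidt-≥2 t {suc (suc a)} o rest 2≤a =
  cong (λ e → (2 + a + length rest , e) ∷ afterFirstHook t (2 + a , o) rest) (endsInBarredOne-∷ o rest 2≤a)
toSchmidt-≥2 t {suc zero} o rest (s≤s ())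

hook-≻ : ∀ {a o c q} l b → (a , o) ≽ (c , q) → (a + suc l , o) ≻ (c + l , b)
hook-≻ {a} l _ (c≤a , o⇒c<a) rewrite +-suc a l =
  s≤s (+-monoˡ-≤ l c≤a) , λ o → s≤s (+-monoˡ-≤ l (o⇒c<a o))

firstHooks-≻ : ∀ a l k e o → (T e → 1 ≤ k) → (2 + a + (l + k) , e) ≻ (suc a + l , o)
firstHooks-≻ a l k e o e⇒1≤k =
  s≤s (+-monoʳ-≤ (suc a) (m≤m+n l k)) ,
  λ e → s≤s (subst (_≤ suc a + (l + k)) (+-suc (suc a) l)
              (+-monoʳ-≤ (suc a) (subst (_≤ l + k) (+-comm l 1) (+-monoʳ-≤ l (e⇒1≤k e)))))

hook-connected : ∀ t {a o} m → Linked _≽_ ((a , o) ∷ m) →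
                 Connected _≻_ (just (a + length m , o)) (head (toSchmidt t m))
hook-connected zero    _              _         = just-nothing
hook-connected (suc t) []             _         = just-nothing
hook-connected (suc t) ((c , q) ∷ m) (c≼ ∷ _) =
  just (hook-≻ {q = q} (length m) (endsInBarredOne ((c , q) ∷ m)) c≼)

removeHook : ∀ t {a o rest} → All Positive ((a , o) ∷ rest) → Linked _≽_ ((a , o) ∷ rest) →
             HasDurfee ((a , o) ∷ rest) (suc t) →
             All Positive (removeColumn rest) × Linked _≽_ (removeColumn rest) × HasDurfee (removeColumn rest) t
removeHook t {rest = rest} pos@(_ ∷ restPos) lnk sq =
  removeColumn-positive rest , removeColumn-linked restPos (Linked.tail lnk) , to (HasDurfee-removeColumn t pos lnk) sq

toSchmidt-strict : ∀ t {xs} → All Positive xs → Linked _≽_ xs → HasDurfee xs t →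
                   IsStrictOverpartition (toSchmidt t xs)
toSchmidt-strict zero    _ _ _ = [] , []
toSchmidt-strict (suc t) [] _ _ = [] , []
toSchmidt-strict (suc t) {(suc zero , _) ∷ _} _ _ _ = s≤s z≤n ∷ [] , [-]
toSchmidt-strict (suc t) {(suc (suc a) , o) ∷ rest} pos@(_ ∷ restPos) lnk sq
  with removeHook t pos lnk sq
... | mPos , mLnk , mSq =
  s≤s z≤n ∷ s≤s z≤n ∷ proj₁ strict ,
  firstHooks ∷ (hook-connected t m (removeColumn-linked pos lnk) ∷′ proj₂ strict)
  where
  m : Parts
  m = removeColumn rest
  strict : IsStrictOverpartition (toSchmidt t m)
  strict = toSchmidt-strict t mPos mLnk mSq
  firstHooks : (2 + a + length rest , endsInBarredOne ((2 + a , o) ∷ rest)) ≻ (suc a + length m , o)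
  firstHooks = subst₂ (λ l e → (2 + a + l , e) ≻ (suc a + length m , o))
    (sym (length-removeColumn restPos (Linked.tail lnk))) (sym (endsInBarredOne-∷ o rest (s≤s (s≤s z≤n))))
    (firstHooks-≻ a (length m) (countOnes rest) (endsInBarredOne rest) o (endsInBarredOne⇒countOnes rest))

toSchmidt-length : ∀ t {xs} → All Positive xs → Linked _≽_ xs → HasDurfee xs t →
                   SchmidtLength t (length (toSchmidt t xs))
toSchmidt-length zero    _ _ _ = empty
toSchmidt-length (suc t) [] _ sq = contradiction (HasDurfee-[] sq) λ ()
toSchmidt-length (suc t) {(suc zero , _) ∷ _} pos@(_ ∷ restPos) lnk sq
  with removeHook t pos lnk sq
... | _ , _ , mSq rewrite removeColumn-onesRun restPos lnk | HasDurfee-[] mSq = single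
toSchmidt-length (suc t) {(suc (suc _) , _) ∷ _} pos lnk sq
  with removeHook t pos lnk sq
... | mPos , mLnk , mSq = step (toSchmidt-length t mPos mLnk mSq)

-- If the inner diagram has ℓ rows, the hooks x > y force a first row of y + 1 − ℓ cells
-- and x − y − 1 new rows of length 1 below it.
fromSchmidt : Parts → Parts
fromSchmidt []                         = []
fromSchmidt ((x , b) ∷ [])             = ones x b
fromSchmidt ((x , b) ∷ (y , c) ∷ rest) =
  (suc y ∸ length (fromSchmidt rest) , c) ∷ addColumn (fromSchmidt rest) (x ∸ suc y) b

firstValue< : ∀ {y c rest} → 1 ≤ y → Linked _≻_ ((y , c) ∷ rest) → firstValue rest < y
firstValue< 1≤y [-]             = 1≤y
firstValue< _   ((z<y , _) ∷ _) = z<y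

column-≽ : ∀ {y c e l b q} → (y , c) ≻ (e + l , b) → (y ∸ l , c) ≽ (suc e , q)
column-≽ {e = e} (e+l<y , c⇒2+e+l≤y) =
  m+n≤o⇒m≤o∸n (suc e) e+l<y , m+n≤o⇒m≤o∸n (2 + e) ∘ c⇒2+e+l≤y

ones-connected : ∀ {a c} k b → 1 ≤ a → (T c → 1 < a) → Connected _≽_ (just (a , c)) (head (ones k b))
ones-connected zero          _ _   _       = just-nothing
ones-connected (suc zero)    _ 1≤a c⇒1<a = just (1≤a , c⇒1<a)
ones-connected (suc (suc _)) _ 1≤a c⇒1<a = just (1≤a , c⇒1<a)

addColumn-connected : ∀ {y c rest} xs k b → All Positive xs → hook xs ≡ firstValue rest → 1 ≤ y →
                      Connected _≻_ (just (y , c)) (head rest) →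
                      Connected _≽_ (just (suc y ∸ length xs , c)) (head (addColumn xs k b))
addColumn-connected [] k b _ _ 1≤y _ = ones-connected k b (s≤s z≤n) (λ _ → s≤s 1≤y)
addColumn-connected {rest = []} ((e , q) ∷ xs) _ _ (1≤e ∷ _) hook≡0 _ _ =
  contradiction hook≡0 (n>0⇒n≢0 (≤-trans 1≤e (m≤m+n e (length xs))))
addColumn-connected {rest = (_ , d) ∷ _} ((_ , q) ∷ _) _ _ _ refl _ (just y≻) =
  just (column-≽ {b = d} {q = q} y≻)

record FromSchmidtFacts (t : ℕ) (μ : Parts) : Set where
  field
    positive   : All Positive (fromSchmidt μ)
    linked     : Linked _≽_ (fromSchmidt μ)
    hasDurfee  : HasDurfee (fromSchmidt μ) t
    hook≡      : hook (fromSchmidt μ) ≡ firstValue μ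
    weight≡    : weight (fromSchmidt μ) ≡ oddWeight μ
    overlined≡ : overlined (fromSchmidt μ) ≡ overlined μ

module FromSchmidtStep {x b y c rest t} (pos : All Positive ((x , b) ∷ (y , c) ∷ rest))
                       (lnk : Linked _≻_ ((x , b) ∷ (y , c) ∷ rest)) (ih : FromSchmidtFacts t rest) where

  private
    module IH = FromSchmidtFacts ih
    L : Parts
    L = fromSchmidt rest

    k : ℕ
    k = x ∸ suc y

    a : ℕ
    a = suc y ∸ length L

    X : Parts
    X = addColumn L k b

    1≤y : 1 ≤ y
    1≤y = All.head (All.tail pos)

    y<x : y < x
    y<x = proj₁ (Linked.head lnk)

    b⇒1≤k : T b → 1 ≤ k
    b⇒1≤k = m<n⇒0<n∸m ∘ proj₂ (Linked.head lnk)

    length<y : length L < y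
    length<y = ≤-<-trans (≤-trans (length≤hook IH.positive) (≤-reflexive IH.hook≡))
                         (firstValue< 1≤y (Linked.tail lnk))

    a≡ : a ≡ suc (y ∸ length L)
    a≡ = +-∸-assoc 1 (<⇒≤ length<y)

    hook-X : a + length X ≡ x
    hook-X = begin
      a + length X          ≡⟨ cong (a +_) (length-addColumn L k b) ⟩
      a + (length L + k)    ≡⟨ +-assoc a (length L) k ⟨
      a + length L + k      ≡⟨ cong (_+ k) (m∸n+n≡m (m≤n⇒m≤1+n (<⇒≤ length<y))) ⟩
      suc y + k             ≡⟨ m+[n∸m]≡n y<x ⟩
      x                     ∎
      where open ≡-Reasoning

    positive : All Positive ((a , c) ∷ X)
    positive = subst (1 ≤_) (sym a≡) (s≤s z≤n) ∷ addColumn-positive L k b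

    linked : Linked _≽_ ((a , c) ∷ X)
    linked = addColumn-connected L k b IH.positive IH.hook≡ 1≤y (Linked.head′ (Linked.tail lnk))
          ∷′ addColumn-linked k b IH.positive IH.linked

  facts : FromSchmidtFacts (suc t) ((x , b) ∷ (y , c) ∷ rest)
  facts = record
    { positive   = positive
    ; linked     = linked
    ; hasDurfee  = from (HasDurfee-removeColumn t positive linked)
                     (subst (λ m → HasDurfee m t) (sym (removeColumn-addColumn k b IH.positive)) IH.hasDurfee)
    ; hook≡      = hook-X
    ; weight≡    = begin
        a + weight X                  ≡⟨ cong (a +_) (weight-addColumn L k b) ⟩
        a + (weight L + length L + k) ≡⟨ solve 4 (λ a w l k → a :+ (w :+ l :+ k) := (a :+ (l :+ k)) :+ w)
                                                 refl a (weight L) (length L) k ⟩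
        a + (length L + k) + weight L ≡⟨ cong (_+ weight L) (cong (a +_) (length-addColumn L k b)) ⟨
        a + length X + weight L       ≡⟨ cong₂ _+_ hook-X IH.weight≡ ⟩
        x + oddWeight rest            ∎
    ; overlined≡ = begin
        barCount c + overlined X
          ≡⟨ cong (barCount c +_) (overlined-addColumn L k b) ⟩
        barCount c + (overlined L + overlined (ones k b))
          ≡⟨ cong₂ (λ u v → barCount c + (u + v)) IH.overlined≡ (overlined-ones k b b⇒1≤k) ⟩
        barCount c + (overlined rest + barCount b)
          ≡⟨ +-assoc (barCount c) (overlined rest) (barCount b) ⟨
        barCount c + overlined rest + barCount b
          ≡⟨ +-comm (barCount c + overlined rest) (barCount b) ⟩
        barCount b + (barCount c + overlined rest)
          ∎
    }
    where
    open ≡-Reasoning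
    open +-*-Solver using (solve; _:+_; _:=_)

  toSchmidt-fromSchmidt-step : toSchmidt t L ≡ rest →
                               toSchmidt (suc t) (fromSchmidt ((x , b) ∷ (y , c) ∷ rest)) ≡ (x , b) ∷ (y , c) ∷ rest
  toSchmidt-fromSchmidt-step ih≡ = begin
    toSchmidt (suc t) ((a , c) ∷ X)
      ≡⟨ toSchmidt-≥2 t c X (subst (2 ≤_) (sym a≡) (s≤s (m<n⇒0<n∸m length<y))) ⟩
    (a + length X , endsInBarredOne X) ∷ (a ∸ 1 + length (removeColumn X) , c) ∷ toSchmidt t (removeColumn X)
      ≡⟨ cong (λ m → (a + length X , endsInBarredOne X) ∷ (a ∸ 1 + length m , c) ∷ toSchmidt t m)
              (removeColumn-addColumn k b IH.positive) ⟩
    (a + length X , endsInBarredOne X) ∷ (a ∸ 1 + length L , c) ∷ toSchmidt t L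
      ≡⟨ cong₂ _∷_ (cong₂ _,_ hook-X endsX) (cong₂ _∷_ (cong (_, c) secondHook) ih≡) ⟩
    (x , b) ∷ (y , c) ∷ rest ∎
    where
    open ≡-Reasoning
    endsX : endsInBarredOne X ≡ b
    endsX = trans (endsInBarredOne-addColumn k b IH.positive) (endsInBarredOne-ones k b b⇒1≤k)
    secondHook : a ∸ 1 + length L ≡ y
    secondHook = trans (cong (λ a → a ∸ 1 + length L) a≡) (m∸n+n≡m (<⇒≤ length<y))

fromSchmidt-facts : ∀ {t μ} → IsStrictOverpartition μ → SchmidtLength t (length μ) → FromSchmidtFacts t μ
fromSchmidt-facts {μ = []} _ empty = record
  { positive = [] ; linked = [] ; hasDurfee = z≤n , z≤n ; hook≡ = refl ; weight≡ = refl ; overlined≡ = refl }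
fromSchmidt-facts {μ = (suc x , b) ∷ []} _ single = record
  { positive   = ones-positive (suc x) b
  ; linked     = ones-linked (suc x) b
  ; hasDurfee  = ones-HasDurfee x b
  ; hook≡      = hook-ones x b
  ; weight≡    = trans (weight-ones (suc x) b) (sym (+-identityʳ (suc x)))
  ; overlined≡ = trans (overlined-ones (suc x) b λ _ → s≤s z≤n) (sym (+-identityʳ (barCount b)))
  }
fromSchmidt-facts {μ = (zero , _) ∷ []} (() ∷ _ , _) single
fromSchmidt-facts {μ = _ ∷ _ ∷ rest} (pos , lnk) (step ℓ) =
  FromSchmidtStep.facts pos lnk (fromSchmidt-facts (All.tail (All.tail pos) , Linked.tail (Linked.tail lnk)) ℓ)

toSchmidt-fromSchmidt : ∀ {t μ} → IsStrictOverpartition μ → SchmidtLength t (length μ) →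
                        toSchmidt t (fromSchmidt μ) ≡ μ
toSchmidt-fromSchmidt {μ = []} _ empty = refl
toSchmidt-fromSchmidt {μ = (suc zero , b) ∷ []} _ single = refl
toSchmidt-fromSchmidt {μ = (suc (suc x) , b) ∷ []} _ single =
  cong₂ (λ l e → (suc l , e) ∷ []) (length-ones (suc x) b) (endsInBarredOne-ones (suc (suc x)) b λ _ → s≤s z≤n)
toSchmidt-fromSchmidt {μ = (zero , _) ∷ []} (() ∷ _ , _) single
toSchmidt-fromSchmidt {μ = _ ∷ _ ∷ rest} (pos , lnk) (step ℓ) =
  FromSchmidtStep.toSchmidt-fromSchmidt-step pos lnk (fromSchmidt-facts restStrict ℓ)
    (toSchmidt-fromSchmidt restStrict ℓ)
  where
  restStrict : IsStrictOverpartition rest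
  restStrict = All.tail (All.tail pos) , Linked.tail (Linked.tail lnk)

fromSchmidt-toSchmidt : ∀ t {xs} → All Positive xs → Linked _≽_ xs → HasDurfee xs t →
                        fromSchmidt (toSchmidt t xs) ≡ xs
fromSchmidt-toSchmidt zero pos _ sq = sym (HasDurfee-0 pos sq)
fromSchmidt-toSchmidt (suc t) [] _ _ = refl
fromSchmidt-toSchmidt (suc t) {(suc zero , o) ∷ rest} (_ ∷ restPos) lnk _ =
  trans (cong (λ l → ones (suc l) (endsInBarredOne ((1 , o) ∷ rest))) length≡countOnes) (sym (onesRun restPos lnk))
  where
  length≡countOnes : length rest ≡ countOnes rest
  length≡countOnes = trans (length-removeColumn restPos (Linked.tail lnk))
                           (cong (λ m → length m + countOnes rest) (removeColumn-onesRun restPos lnk))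
fromSchmidt-toSchmidt (suc t) {(suc (suc a) , o) ∷ rest} pos@(_ ∷ restPos) lnk sq
  with removeHook t pos lnk sq
... | mPos , mLnk , mSq = begin
  (2 + a + length m ∸ length (fromSchmidt (toSchmidt t m)) , o)
    ∷ addColumn (fromSchmidt (toSchmidt t m)) k (endsInBarredOne λs)
    ≡⟨ cong (λ L → (2 + a + length m ∸ length L , o) ∷ addColumn L k (endsInBarredOne λs))
            (fromSchmidt-toSchmidt t mPos mLnk mSq) ⟩
  (2 + a + length m ∸ length m , o) ∷ addColumn m k (endsInBarredOne λs)
    ≡⟨ cong₂ (λ h e → (h , o) ∷ addColumn m k e)
             (m+n∸n≡m (2 + a) (length m)) (endsInBarredOne-∷ o rest (s≤s (s≤s z≤n))) ⟩
  (2 + a , o) ∷ addColumn m k (endsInBarredOne rest)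
    ≡⟨ cong (λ k → (2 + a , o) ∷ addColumn m k (endsInBarredOne rest)) k≡countOnes ⟩
  (2 + a , o) ∷ addColumn m (countOnes rest) (endsInBarredOne rest)
    ≡⟨ cong ((2 + a , o) ∷_) (column-decomposition restPos (Linked.tail lnk)) ⟨
  λs ∎
  where
  open ≡-Reasoning
  λs : Parts
  λs = (2 + a , o) ∷ rest
  m : Parts
  m = removeColumn rest
  k : ℕ
  k = 2 + a + length rest ∸ (2 + a + length m)
  k≡countOnes : k ≡ countOnes rest
  k≡countOnes = begin
    2 + a + length rest ∸ (2 + a + length m)  ≡⟨ [m+n]∸[m+o]≡n∸o (2 + a) (length rest) (length m) ⟩
    length rest ∸ length m                    ≡⟨ cong (_∸ length m) (length-removeColumn restPos (Linked.tail lnk)) ⟩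
    length m + countOnes rest ∸ length m      ≡⟨ m+n∸m≡n (length m) (countOnes rest) ⟩
    countOnes rest                            ∎

IsOverpartitionDurfee : ℕ → ℕ → ℕ → Parts → Set
IsOverpartitionDurfee n s t xs = IsOverpartition xs × weight xs ≡ n × overlined xs ≡ s × HasDurfee xs t

IsSchmidt2Length : ℕ → ℕ → ℕ → Parts → Set
IsSchmidt2Length n s t xs =
  IsStrictOverpartition xs × oddWeight xs ≡ n × overlined xs ≡ s × SchmidtLength t (length xs)

isOverpartitionDurfee⇔ : ∀ {n s t} xs →
  T (isOverpartition xs ∧ (weight xs ≡ᵇ n) ∧ (overlined xs ≡ᵇ s) ∧ (durfee xs ≡ᵇ t)) ⇔
  IsOverpartitionDurfee n s t xs
isOverpartitionDurfee⇔ {t = t} xs =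
  ⇔-trans T-∧ (⇔-trans T-∧ (allPos⇔ xs ×-⇔ overOK⇔ xs) ×-⇔
  ⇔-trans T-∧ (≡ᵇ⇔ ×-⇔ ⇔-trans T-∧ (≡ᵇ⇔ ×-⇔ ⇔-trans ≡ᵇ⇔ (durfee⇔HasDurfee xs t))))

isSchmidt2Length⇔ : ∀ {n s t} xs →
  T (isStrictOverpartition xs ∧ (oddWeight xs ≡ᵇ n) ∧ (overlined xs ≡ᵇ s)
     ∧ ((length xs ≡ᵇ 2 * t) ∨ (length xs ≡ᵇ 2 * t ∸ 1))) ⇔ IsSchmidt2Length n s t xs
isSchmidt2Length⇔ xs =
  ⇔-trans T-∧ (⇔-trans T-∧ (allPos⇔ xs ×-⇔ strictOK⇔ xs) ×-⇔
  ⇔-trans T-∧ (≡ᵇ⇔ ×-⇔ ⇔-trans T-∧ (≡ᵇ⇔ ×-⇔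
  ⇔-trans (⇔-trans T-∨ (≡ᵇ⇔ ⊎-⇔ ≡ᵇ⇔)) SchmidtLength⇔)))

toSchmidt-correct : ∀ {n s t xs} → IsOverpartitionDurfee n s t xs → IsSchmidt2Length n s t (toSchmidt t xs)
toSchmidt-correct {t = t} {xs} ((pos , lnk) , refl , refl , sq) =
  strict , trans (sym F.weight≡) (cong weight inverse) , trans (sym F.overlined≡) (cong overlined inverse) , len
  where
  strict : IsStrictOverpartition (toSchmidt t xs)
  strict = toSchmidt-strict t pos lnk sq
  len : SchmidtLength t (length (toSchmidt t xs))
  len = toSchmidt-length t pos lnk sq
  module F = FromSchmidtFacts (fromSchmidt-facts strict len)
  inverse : fromSchmidt (toSchmidt t xs) ≡ xs
  inverse = fromSchmidt-toSchmidt t pos lnk sq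

fromSchmidt-correct : ∀ {n s t μ} → IsSchmidt2Length n s t μ → IsOverpartitionDurfee n s t (fromSchmidt μ)
fromSchmidt-correct (strict , refl , refl , len) = (F.positive , F.linked) , F.weight≡ , F.overlined≡ , F.hasDurfee
  where module F = FromSchmidtFacts (fromSchmidt-facts strict len)

restrict-↔ : ∀ {A B : Set} {P : A → Bool} {Q : B → Bool} (f : A → B) (g : B → A) →
             (∀ {x} → T (P x) → T (Q (f x))) → (∀ {y} → T (Q y) → T (P (g y))) →
             (∀ {x} → T (P x) → g (f x) ≡ x) → (∀ {y} → T (Q y) → f (g y) ≡ y) →
             Σ A (λ x → T (P x)) ↔ Σ B (λ y → T (Q y))
restrict-↔ f g f-resp g-resp g∘f f∘g = mk↔ₛ′
  (λ (x , p) → f x , f-resp p) (λ (y , q) → g y , g-resp q)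
  (λ (y , q) → Σ-≡ (f∘g q)) (λ (x , p) → Σ-≡ (g∘f p))
  where
  Σ-≡ : ∀ {C : Set} {R : C → Bool} {x y} {p : T (R x)} {q : T (R y)} → x ≡ y → (x , p) ≡ (y , q)
  Σ-≡ refl = cong (_ ,_) (T-irrelevant _ _)

corollary4 : (n t s : ℕ) → 1 ≤ n → 1 ≤ t →
    OverpartitionsDurfee n s t ↔ Schmidt2Length n s t
corollary4 n t s _ _ = restrict-↔ (toSchmidt t) fromSchmidt
  (λ {xs} → from (isSchmidt2Length⇔ (toSchmidt t xs)) ∘ toSchmidt-correct ∘ to (isOverpartitionDurfee⇔ xs))
  (λ {μ} → from (isOverpartitionDurfee⇔ (fromSchmidt μ)) ∘ fromSchmidt-correct ∘ to (isSchmidt2Length⇔ μ))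
  (λ p → let ((pos , lnk) , _ , _ , sq) = to (isOverpartitionDurfee⇔ _) p in fromSchmidt-toSchmidt t pos lnk sq)
  (λ q → let (strict , _ , _ , len) = to (isSchmidt2Length⇔ _) q in toSchmidt-fromSchmidt strict len)
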